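{- Let $G$ be a graph and let $C$ be a proper cycle in $G$ (a cycle subgraph on $q\ge 3$ vertices). Then for every graph $H$, \[ I((G,C)\circ 2H;x)=I(H;x)^{|C|}\cdot I((G,C)\bigtriangleup H;x), \] where $|C|=q$ is the number of vertices of $C$.
   Context: All graphs are finite and simple. For a graph $G$, $I(G;x)=\sum_{k\ge0}s_kx^k$ where $s_k$ is the number of independent sets (sets of pairwise non-adjacent vertices) of size $k$. $2H$ denotes the disjoint union of two copies of $H$. $(G,C)\circ 2H$ is the graph obtained from $G$ by adding, for each vertex $v$ of $C$, its own disjoint copy of $2H$, with $v$ joined to all vertices of that copy. $(G,C)\bigtriangleup H$ is the graph obtained from $G$ and $q$ disjoint copies of $H$, one for each edge of $C$, such that the two endpoints of each edge of $C$ (two consecutive vertices on $C$) are joined to all vertices of the corresponding copy of $H$. -}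

module Defs where

open import Data.Bool using (Bool; true; false; _∧_; _∨_; not; if_then_else_)
open import Data.Nat using (ℕ; zero; suc; _+_; _*_; _∸_; _≤_)
open import Data.Nat.DivMod using (_%_; m%n<n)
open import Data.Fin using (Fin; toℕ; fromℕ<; splitAt; remQuot; _≟_)
open import Data.Fin.Properties using ()
open import Data.Vec using (Vec; []; _∷_; lookup)
open import Data.List using (List; []; _∷_; map; _++_; length; filterᵇ; upTo; allFin)
open import Data.Bool.ListAction using (and)
open import Data.Nat.ListAction using (sum)
open import Data.Sum using (_⊎_; inj₁; inj₂)
open import Data.Product using (_×_; _,_)
open import Relation.Nullary.Decidable using (⌊_⌋)
open import Relation.Binary.PropositionalEquality using (_≡_; _≢_)
open import Function.Definitions using (Injective)

record Graph : Set where
  field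
    size    : ℕ
    adj     : Fin size → Fin size → Bool
    sym     : ∀ u v → adj u v ≡ adj v u
    irrefl  : ∀ u → adj u u ≡ false

open Graph public

-- Polynomials with natural coefficients, as coefficient sequences.

Poly : Set
Poly = ℕ → ℕ

_⊗_ : Poly → Poly → Poly
(p ⊗ r) k = sum (map (λ i → p i * r (k ∸ i)) (upTo (suc k)))

one : Poly
one zero    = 1
one (suc _) = 0

_^^_ : Poly → ℕ → Poly
p ^^ zero  = one
p ^^ suc e = p ⊗ (p ^^ e)

allSubsets : (n : ℕ) → List (Vec Bool n)
allSubsets zero    = [] ∷ []
allSubsets (suc n) = map (true ∷_) (allSubsets n) ++ map (false ∷_) (allSubsets n)

card : ∀ {n} → Vec Bool n → ℕ
card []           = 0
card (true ∷ s)   = suc (card s)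
card (false ∷ s)  = card s

isIndependent : ∀ {n} → (Fin n → Fin n → Bool) → Vec Bool n → Bool
isIndependent {n} a S =
  and (map (λ u → and (map (λ v →
        not (lookup S u ∧ lookup S v ∧ not ⌊ u ≟ v ⌋ ∧ a u v))
      (allFin n))) (allFin n))

indepPolyAdj : ∀ {n} → (Fin n → Fin n → Bool) → Poly
indepPolyAdj {n} a k =
  length (filterᵇ (λ S → ⌊ Data.Nat._≟_ (card S) k ⌋ Data.Bool.∧ isIndependent a S)
                 (allSubsets n))
  where import Data.Nat; import Data.Bool

I : Graph → Poly
I G = indepPolyAdj (adj G)

nextIdx : ∀ {q} → Fin (suc q) → Fin (suc q)
nextIdx {q} i = fromℕ< (m%n<n (suc (toℕ i)) (suc q))

record Cycle (G : Graph) : Set where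
  field
    len      : ℕ        -- the cycle has  suc len  vertices (|C| = suc len)
    len≥3    : 3 ≤ suc len
    vtx      : Fin (suc len) → Fin (size G)
    vtx-inj  : Injective _≡_ _≡_ vtx
    edges    : ∀ i → adj G (vtx i) (vtx (nextIdx i)) ≡ true

open Cycle public

∣_∣C : ∀ {G} → Cycle G → ℕ
∣ C ∣C = suc (len C)

private
  eqF : ∀ {k} → Fin k → Fin k → Bool
  eqF x y = ⌊ x ≟ y ⌋

-- (G,C) ∘ 2H : vertices  Fin n ⊎ (Fin q × (Fin m ⊎ Fin m))  encoded in
-- Fin (n + q * (m + m)).
coronaVtx : (n q m : ℕ) → Fin (n + q * (m + m)) → Fin n ⊎ (Fin q × (Fin m ⊎ Fin m))
coronaVtx n q m x with splitAt n x
... | inj₁ u = inj₁ u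
... | inj₂ y with remQuot {q} (m + m) y
...   | (k , z) = inj₂ (k , splitAt m z)

module _ (G : Graph) (C : Cycle G) (H : Graph) where
  private
    n = size G
    q = ∣ C ∣C
    m = size H

    corAdj' : Fin n ⊎ (Fin q × (Fin m ⊎ Fin m)) → Fin n ⊎ (Fin q × (Fin m ⊎ Fin m)) → Bool
    corAdj' (inj₁ u) (inj₁ v) = adj G u v
    corAdj' (inj₁ u) (inj₂ (k , _)) = eqF u (vtx C k)
    corAdj' (inj₂ (k , _)) (inj₁ u) = eqF u (vtx C k)
    corAdj' (inj₂ (k , inj₁ x)) (inj₂ (k' , inj₁ y)) = eqF k k' ∧ adj H x y
    corAdj' (inj₂ (k , inj₂ x)) (inj₂ (k' , inj₂ y)) = eqF k k' ∧ adj H x y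
    corAdj' (inj₂ (_ , inj₁ _)) (inj₂ (_ , inj₂ _)) = false
    corAdj' (inj₂ (_ , inj₂ _)) (inj₂ (_ , inj₁ _)) = false

    triVtx : Fin (n + q * m) → Fin n ⊎ (Fin q × Fin m)
    triVtx x with splitAt n x
    ... | inj₁ u = inj₁ u
    ... | inj₂ y = inj₂ (remQuot {q} m y)

    -- copy k of H belongs to the edge {c k, c (k+1 mod q)} of C
    triAdj' : Fin n ⊎ (Fin q × Fin m) → Fin n ⊎ (Fin q × Fin m) → Bool
    triAdj' (inj₁ u) (inj₁ v) = adj G u v
    triAdj' (inj₁ u) (inj₂ (k , _)) = eqF u (vtx C k) ∨ eqF u (vtx C (nextIdx k))
    triAdj' (inj₂ (k , _)) (inj₁ u) = eqF u (vtx C k) ∨ eqF u (vtx C (nextIdx k))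
    triAdj' (inj₂ (k , x)) (inj₂ (k' , y)) = eqF k k' ∧ adj H x y

  coronaAdj : Fin (n + q * (m + m)) → Fin (n + q * (m + m)) → Bool
  coronaAdj x y = corAdj' (coronaVtx n q m x) (coronaVtx n q m y)

  triAdj : Fin (n + q * m) → Fin (n + q * m) → Bool
  triAdj x y = triAdj' (triVtx x) (triVtx y)

  I-corona : Poly
  I-corona = indepPolyAdj coronaAdj

  I-triangle : Poly
  I-triangle = indepPolyAdj triAdj

module Submission where

-- Both graphs are pendant-block graphs: G plus q disjoint copies of a block
-- graph K, copy i being joined completely to some vertices of G.  An
-- independent set is an independent set S of G together with, in each copy,
-- nothing if S meets the vertices attached to it and any independent set of K
-- otherwise; so I = Σ_{S indep. in G} x^|S| ∏_i (1 if S hits copy i else I(K))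
-- (pendant-indepPoly).  For the corona K = 2H hangs at c_i and I(2H) = I(H)²
-- (union-indepPoly); for the triangle construction K = H hangs at both ends of
-- the i-th cycle edge.  Since S never contains two consecutive cycle vertices,
-- cycle-identity turns I(H)^q times the triangle term of S into the corona term.

open import Defs hiding (sym)
open import Data.Nat using (ℕ; zero; suc; _+_; _*_; _∸_; _<_; z≤n; s≤s; _%_)
import Data.Nat as ℕ
open import Data.Nat.Properties
  using ( +-identityʳ; +-assoc; +-comm; *-zeroʳ; *-comm; *-assoc; *-distribˡ-+; *-distribʳ-+
        ; +-∸-assoc; ∸-+-assoc; n∸n≡0; m∸[m∸n]≡n; m+[n∸m]≡n; ≤-pred; +-commutativeSemigroup )
open import Data.Nat.DivMod using (m<n⇒m%n≡m; n%n≡0)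
open import Data.Nat.ListAction using (sum)
open import Data.Bool using (Bool; true; false; _∧_; _∨_; not; if_then_else_)
open import Data.Bool.Properties
  using (T-≡; ∧-zeroʳ; ∧-conicalˡ; ∧-conicalʳ; ∨-conicalˡ; ∨-conicalʳ; not-involutive; ⇔→≡)
open import Data.Bool.ListAction using (and; all)
open import Data.List using (List; []; _∷_; map; applyUpTo; length; filterᵇ; allFin)
  renaming (_++_ to _++ₗ_)
open import Data.List.Properties using (map-cong)
import Data.List.Relation.Unary.All as All
open import Data.List.Relation.Unary.All.Properties using (all⁺; all⁻; tabulate⁺)
open import Data.List.Membership.Propositional.Properties using (∈-allFin)
open import Data.Vec using (Vec; []; _∷_; _++_; concat; lookup)
open import Data.Vec.Properties using (lookup-splitAt; lookup-concat)
open import Data.Fin using (Fin; zero; suc; _≟_; toℕ; fromℕ; inject₁; splitAt; join; remQuot; combine)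
open import Data.Fin.Properties
  using ( toℕ-injective; toℕ-fromℕ<; toℕ-inject₁; toℕ-fromℕ; toℕ<n
        ; splitAt-join; remQuot-combine; combine-remQuot )
open import Data.Sum using (_⊎_; inj₁; inj₂; [_,_]′)
import Data.Sum as Sum
open import Data.Product using (_×_; _,_; proj₁; proj₂; uncurry)
open import Data.Empty using (⊥-elim)
open import Function.Bundles using (_⇔_; mk⇔; Equivalence)
open import Function.Construct.Composition using () renaming (equivalence to ⇔-trans)
open import Relation.Nullary.Decidable using (⌊_⌋; yes; no; dec-true; isYes≗does)
open import Relation.Binary.PropositionalEquality
open import Relation.Binary.Structures using (IsEquivalence)
open import Level using (0ℓ)
open import Algebra.Bundles using (CommutativeMonoid)
open import Algebra.Structures using (IsCommutativeMonoid)
open import Algebra.Properties.CommutativeSemigroup +-commutativeSemigroup using (interchange)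
import Algebra.Properties.CommutativeMonoid.Sum as MonoidSum
import Algebra.Properties.CommutativeSemigroup as SemigroupProperties
import Relation.Binary.Reasoning.Setoid as SetoidReasoning
open Equivalence using (to; from)

sumℕ : ℕ → (ℕ → ℕ) → ℕ
sumℕ zero    f = 0
sumℕ (suc n) f = f 0 + sumℕ n (λ i → f (suc i))

syntax sumℕ n (λ i → e) = ∑[ i < n ] e

⊗-coeff : ∀ p r k → (p ⊗ r) k ≡ ∑[ i < suc k ] (p i * r (k ∸ i))
⊗-coeff p r k = sum-applyUpTo (λ i → i) (suc k)
  where
  sum-applyUpTo : ∀ (g : ℕ → ℕ) n →
    sum (map (λ i → p i * r (k ∸ i)) (applyUpTo g n)) ≡ ∑[ i < n ] (p (g i) * r (k ∸ g i))
  sum-applyUpTo g zero    = refl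
  sum-applyUpTo g (suc n) = cong (p (g 0) * r (k ∸ g 0) +_) (sum-applyUpTo (λ i → g (suc i)) n)

sumℕ-cong : ∀ n {f g : ℕ → ℕ} → (∀ i → i < n → f i ≡ g i) → sumℕ n f ≡ sumℕ n g
sumℕ-cong zero    eq = refl
sumℕ-cong (suc n) eq = cong₂ _+_ (eq 0 (s≤s z≤n)) (sumℕ-cong n (λ i i<n → eq (suc i) (s≤s i<n)))

sumℕ-ext : ∀ n {f g : ℕ → ℕ} → (∀ i → f i ≡ g i) → sumℕ n f ≡ sumℕ n g
sumℕ-ext n eq = sumℕ-cong n (λ i _ → eq i)

sumℕ-zero : ∀ n → ∑[ i < n ] 0 ≡ 0
sumℕ-zero zero    = refl
sumℕ-zero (suc n) = sumℕ-zero n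

sumℕ-+ : ∀ n (f g : ℕ → ℕ) → ∑[ i < n ] (f i + g i) ≡ sumℕ n f + sumℕ n g
sumℕ-+ zero    f g = refl
sumℕ-+ (suc n) f g = begin
  (f 0 + g 0) + ∑[ i < n ] (f (suc i) + g (suc i))
    ≡⟨ cong ((f 0 + g 0) +_) (sumℕ-+ n (λ i → f (suc i)) (λ i → g (suc i))) ⟩
  (f 0 + g 0) + (sumℕ n (λ i → f (suc i)) + sumℕ n (λ i → g (suc i)))
    ≡⟨ interchange (f 0) (g 0) _ _ ⟩
  (f 0 + sumℕ n (λ i → f (suc i))) + (g 0 + sumℕ n (λ i → g (suc i))) ∎
  where open ≡-Reasoning

sumℕ-*ˡ : ∀ n c (f : ℕ → ℕ) → c * sumℕ n f ≡ ∑[ i < n ] (c * f i)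
sumℕ-*ˡ zero    c f = *-zeroʳ c
sumℕ-*ˡ (suc n) c f =
  trans (*-distribˡ-+ c (f 0) _) (cong (c * f 0 +_) (sumℕ-*ˡ n c (λ i → f (suc i))))

sumℕ-*ʳ : ∀ n c (f : ℕ → ℕ) → sumℕ n f * c ≡ ∑[ i < n ] (f i * c)
sumℕ-*ʳ n c f =
  trans (*-comm (sumℕ n f) c) (trans (sumℕ-*ˡ n c f) (sumℕ-ext n (λ i → *-comm c (f i))))

sumℕ-last : ∀ n (f : ℕ → ℕ) → sumℕ (suc n) f ≡ sumℕ n f + f n
sumℕ-last zero    f = +-identityʳ (f 0)
sumℕ-last (suc n) f = begin
  f 0 + sumℕ (suc n) (λ i → f (suc i))        ≡⟨ cong (f 0 +_) (sumℕ-last n (λ i → f (suc i))) ⟩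
  f 0 + (sumℕ n (λ i → f (suc i)) + f (suc n)) ≡⟨ +-assoc (f 0) _ _ ⟨
  (f 0 + sumℕ n (λ i → f (suc i))) + f (suc n) ∎
  where open ≡-Reasoning

sumℕ-reverse : ∀ n (f : ℕ → ℕ) → ∑[ i < suc n ] f i ≡ ∑[ i < suc n ] f (n ∸ i)
sumℕ-reverse zero    f = refl
sumℕ-reverse (suc n) f = begin
  f 0 + ∑[ i < suc n ] f (suc i)        ≡⟨ cong (f 0 +_) (sumℕ-reverse n (λ i → f (suc i))) ⟩
  f 0 + ∑[ i < suc n ] f (suc (n ∸ i))
    ≡⟨ cong (f 0 +_) (sumℕ-cong (suc n) (λ i i≤n → cong f (+-∸-assoc 1 (≤-pred i≤n)))) ⟨
  f 0 + ∑[ i < suc n ] f (suc n ∸ i)    ≡⟨ +-comm (f 0) _ ⟩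
  ∑[ i < suc n ] f (suc n ∸ i) + f 0    ≡⟨ cong (λ j → ∑[ i < suc n ] f (suc n ∸ i) + f j) (n∸n≡0 (suc n)) ⟨
  ∑[ i < suc n ] f (suc n ∸ i) + f (suc n ∸ suc n) ≡⟨ sumℕ-last (suc n) (λ i → f (suc n ∸ i)) ⟨
  ∑[ i < suc (suc n) ] f (suc n ∸ i) ∎
  where open ≡-Reasoning

sumℕ-triangle : ∀ k (F : ℕ → ℕ → ℕ) →
  ∑[ i < suc k ] ∑[ j < suc i ] F j (i ∸ j) ≡ ∑[ j < suc k ] ∑[ l < suc (k ∸ j) ] F j l
sumℕ-triangle zero    F = refl
sumℕ-triangle (suc k) F = begin
  ∑[ i < suc (suc k) ] ∑[ j < suc i ] F j (i ∸ j)
    ≡⟨ sumℕ-last (suc k) (λ i → ∑[ j < suc i ] F j (i ∸ j)) ⟩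
  ∑[ i < suc k ] ∑[ j < suc i ] F j (i ∸ j) + ∑[ j < suc (suc k) ] F j (suc k ∸ j)
    ≡⟨ cong₂ _+_ (sumℕ-triangle k F) (sumℕ-last (suc k) (λ j → F j (suc k ∸ j))) ⟩
  ∑[ j < suc k ] ∑[ l < suc (k ∸ j) ] F j l + (∑[ j < suc k ] F j (suc k ∸ j) + F (suc k) (k ∸ k))
    ≡⟨ +-assoc (∑[ j < suc k ] ∑[ l < suc (k ∸ j) ] F j l) _ _ ⟨
  (∑[ j < suc k ] ∑[ l < suc (k ∸ j) ] F j l + ∑[ j < suc k ] F j (suc k ∸ j)) + F (suc k) (k ∸ k)
    ≡⟨ cong₂ _+_ (sumℕ-+ (suc k) (λ j → ∑[ l < suc (k ∸ j) ] F j l) (λ j → F j (suc k ∸ j)))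
                 (cong (F (suc k)) (sym (n∸n≡0 k))) ⟨
  ∑[ j < suc k ] (∑[ l < suc (k ∸ j) ] F j l + F j (suc k ∸ j)) + F (suc k) 0
    ≡⟨ cong₂ _+_ (sumℕ-cong (suc k) row) (+-identityʳ (F (suc k) 0)) ⟨
  ∑[ j < suc k ] ∑[ l < suc (suc k ∸ j) ] F j l + (F (suc k) 0 + 0)
    ≡⟨ cong (λ d → ∑[ j < suc k ] ∑[ l < suc (suc k ∸ j) ] F j l + ∑[ l < suc d ] F (suc k) l) (n∸n≡0 k) ⟨
  ∑[ j < suc k ] ∑[ l < suc (suc k ∸ j) ] F j l + ∑[ l < suc (k ∸ k) ] F (suc k) l
    ≡⟨ sumℕ-last (suc k) (λ j → ∑[ l < suc (suc k ∸ j) ] F j l) ⟨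
  ∑[ j < suc (suc k) ] ∑[ l < suc (suc k ∸ j) ] F j l ∎
  where
  open ≡-Reasoning
  row : ∀ j → j < suc k →
        ∑[ l < suc (suc k ∸ j) ] F j l ≡ ∑[ l < suc (k ∸ j) ] F j l + F j (suc k ∸ j)
  row j (s≤s j≤k) rewrite +-∸-assoc 1 j≤k = sumℕ-last (suc (k ∸ j)) (F j)

infix  4 _≋_
infixl 6 _⊕_

_≋_ : Poly → Poly → Set
p ≋ r = ∀ k → p k ≡ r k

≋-isEquivalence : IsEquivalence _≋_
≋-isEquivalence = record
  { refl  = λ k → refl
  ; sym   = λ p≋r k → sym (p≋r k)
  ; trans = λ p≋r r≋s k → trans (p≋r k) (r≋s k)
  }

_⊕_ : Poly → Poly → Poly
(p ⊕ r) k = p k + r k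

0ₚ : Poly
0ₚ _ = 0

⊕-cong : ∀ {p p′ r r′} → p ≋ p′ → r ≋ r′ → p ⊕ r ≋ p′ ⊕ r′
⊕-cong p≋p′ r≋r′ k = cong₂ _+_ (p≋p′ k) (r≋r′ k)

⊗-cong : ∀ {p p′ r r′} → p ≋ p′ → r ≋ r′ → p ⊗ r ≋ p′ ⊗ r′
⊗-cong {p} {p′} {r} {r′} p≋p′ r≋r′ k = begin
  (p ⊗ r) k                              ≡⟨ ⊗-coeff p r k ⟩
  ∑[ i < suc k ] (p i * r (k ∸ i))       ≡⟨ sumℕ-ext (suc k) (λ i → cong₂ _*_ (p≋p′ i) (r≋r′ (k ∸ i))) ⟩
  ∑[ i < suc k ] (p′ i * r′ (k ∸ i))     ≡⟨ ⊗-coeff p′ r′ k ⟨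
  (p′ ⊗ r′) k                            ∎
  where open ≡-Reasoning

⊗-congˡ : ∀ p {r r′} → r ≋ r′ → p ⊗ r ≋ p ⊗ r′
⊗-congˡ p = ⊗-cong {p} {p} (λ k → refl)

⊗-congʳ : ∀ {p p′} r → p ≋ p′ → p ⊗ r ≋ p′ ⊗ r
⊗-congʳ {p} {p′} r p≋p′ = ⊗-cong {p} {p′} {r} {r} p≋p′ (λ k → refl)

⊗-comm : ∀ p r → p ⊗ r ≋ r ⊗ p
⊗-comm p r k = begin
  (p ⊗ r) k                                    ≡⟨ ⊗-coeff p r k ⟩
  ∑[ i < suc k ] (p i * r (k ∸ i))             ≡⟨ sumℕ-reverse k (λ i → p i * r (k ∸ i)) ⟩
  ∑[ i < suc k ] (p (k ∸ i) * r (k ∸ (k ∸ i))) ≡⟨ sumℕ-cong (suc k) swap ⟩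
  ∑[ i < suc k ] (r i * p (k ∸ i))             ≡⟨ ⊗-coeff r p k ⟨
  (r ⊗ p) k                                    ∎
  where
  open ≡-Reasoning
  swap : ∀ i → i < suc k → p (k ∸ i) * r (k ∸ (k ∸ i)) ≡ r i * p (k ∸ i)
  swap i (s≤s i≤k) rewrite m∸[m∸n]≡n i≤k = *-comm (p (k ∸ i)) (r i)

⊗-identityˡ : ∀ p → one ⊗ p ≋ p
⊗-identityˡ p k = begin
  (one ⊗ p) k                  ≡⟨ ⊗-coeff one p k ⟩
  (p k + 0) + ∑[ i < k ] 0     ≡⟨ cong ((p k + 0) +_) (sumℕ-zero k) ⟩
  (p k + 0) + 0                ≡⟨ trans (+-identityʳ _) (+-identityʳ _) ⟩
  p k                          ∎
  where open ≡-Reasoning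

⊗-zeroˡ : ∀ p → 0ₚ ⊗ p ≋ 0ₚ
⊗-zeroˡ p k = trans (⊗-coeff 0ₚ p k) (sumℕ-zero (suc k))

⊗-distribʳ : ∀ p r s → (p ⊕ r) ⊗ s ≋ p ⊗ s ⊕ r ⊗ s
⊗-distribʳ p r s k = begin
  ((p ⊕ r) ⊗ s) k                                        ≡⟨ ⊗-coeff (p ⊕ r) s k ⟩
  ∑[ i < suc k ] ((p i + r i) * s (k ∸ i))               ≡⟨ sumℕ-ext (suc k) (λ i → *-distribʳ-+ (s (k ∸ i)) (p i) (r i)) ⟩
  ∑[ i < suc k ] (p i * s (k ∸ i) + r i * s (k ∸ i))     ≡⟨ sumℕ-+ (suc k) (λ i → p i * s (k ∸ i)) (λ i → r i * s (k ∸ i)) ⟩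
  ∑[ i < suc k ] (p i * s (k ∸ i)) + ∑[ i < suc k ] (r i * s (k ∸ i))
                                                         ≡⟨ cong₂ _+_ (⊗-coeff p s k) (⊗-coeff r s k) ⟨
  (p ⊗ s) k + (r ⊗ s) k                                  ∎
  where open ≡-Reasoning

-- Associativity: both sides are the sum of p j * r l * s (k - j - l) over j + l ≤ k.
⊗-assoc : ∀ p r s → (p ⊗ r) ⊗ s ≋ p ⊗ (r ⊗ s)
⊗-assoc p r s k = begin
  ((p ⊗ r) ⊗ s) k
    ≡⟨ ⊗-coeff (p ⊗ r) s k ⟩
  ∑[ i < suc k ] ((p ⊗ r) i * s (k ∸ i))
    ≡⟨ sumℕ-ext (suc k) (λ i → cong (_* s (k ∸ i)) (⊗-coeff p r i)) ⟩
  ∑[ i < suc k ] (∑[ j < suc i ] (p j * r (i ∸ j)) * s (k ∸ i))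
    ≡⟨ sumℕ-ext (suc k) (λ i → sumℕ-*ʳ (suc i) (s (k ∸ i)) (λ j → p j * r (i ∸ j))) ⟩
  ∑[ i < suc k ] ∑[ j < suc i ] (p j * r (i ∸ j) * s (k ∸ i))
    ≡⟨ sumℕ-ext (suc k) (λ i → sumℕ-cong (suc i) (λ j j≤i → cong (λ m → p j * r (i ∸ j) * s (k ∸ m))
                                                                  (sym (m+[n∸m]≡n (≤-pred j≤i))))) ⟩
  ∑[ i < suc k ] ∑[ j < suc i ] F j (i ∸ j)
    ≡⟨ sumℕ-triangle k F ⟩
  ∑[ j < suc k ] ∑[ l < suc (k ∸ j) ] F j l
    ≡⟨ sumℕ-ext (suc k) (λ j → sumℕ-ext (suc (k ∸ j)) (λ l →
         trans (*-assoc (p j) (r l) _) (cong (λ m → p j * (r l * s m)) (sym (∸-+-assoc k j l))))) ⟩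
  ∑[ j < suc k ] ∑[ l < suc (k ∸ j) ] (p j * (r l * s (k ∸ j ∸ l)))
    ≡⟨ sumℕ-ext (suc k) (λ j → sumℕ-*ˡ (suc (k ∸ j)) (p j) (λ l → r l * s (k ∸ j ∸ l))) ⟨
  ∑[ j < suc k ] (p j * ∑[ l < suc (k ∸ j) ] (r l * s (k ∸ j ∸ l)))
    ≡⟨ sumℕ-ext (suc k) (λ j → cong (p j *_) (⊗-coeff r s (k ∸ j))) ⟨
  ∑[ j < suc k ] (p j * (r ⊗ s) (k ∸ j))
    ≡⟨ ⊗-coeff p (r ⊗ s) k ⟨
  (p ⊗ (r ⊗ s)) k ∎
  where
  open ≡-Reasoning
  F : ℕ → ℕ → ℕ
  F j l = p j * r l * s (k ∸ (j + l))

⊗-isCommutativeMonoid : IsCommutativeMonoid _≋_ _⊗_ one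
⊗-isCommutativeMonoid = record
  { isMonoid = record
    { isSemigroup = record
      { isMagma = record { isEquivalence = ≋-isEquivalence ; ∙-cong = ⊗-cong }
      ; assoc   = ⊗-assoc
      }
    ; identity = ⊗-identityˡ , λ p → IsEquivalence.trans ≋-isEquivalence (⊗-comm p one) (⊗-identityˡ p)
    }
  ; comm = ⊗-comm
  }

⊗-commutativeMonoid : CommutativeMonoid 0ℓ 0ℓ
⊗-commutativeMonoid = record { isCommutativeMonoid = ⊗-isCommutativeMonoid }

open CommutativeMonoid ⊗-commutativeMonoid
  using () renaming (setoid to ≋-setoid; refl to ≋-refl; sym to ≋-sym; trans to ≋-trans; reflexive to ≡⇒≋)
open MonoidSum ⊗-commutativeMonoid
  using () renaming (sum to ∏; sum-cong-≋ to ∏-cong; ∑-distrib-+ to ∏-distrib-⊗; sum-init-last to ∏-init-last)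
open SemigroupProperties (CommutativeMonoid.commutativeSemigroup ⊗-commutativeMonoid) using (x∙yz≈y∙xz)
module ≋-Reasoning = SetoidReasoning ≋-setoid

mono : ℕ → Poly
mono zero          = one
mono (suc a) zero    = 0
mono (suc a) (suc k) = mono a k

mono-diag : ∀ a → mono a a ≡ 1
mono-diag zero    = refl
mono-diag (suc a) = mono-diag a

mono-off : ∀ a k → a ≢ k → mono a k ≡ 0
mono-off zero    zero    a≢k = ⊥-elim (a≢k refl)
mono-off zero    (suc k) a≢k = refl
mono-off (suc a) zero    a≢k = refl
mono-off (suc a) (suc k) a≢k = mono-off a k (λ a≡k → a≢k (cong suc a≡k))

mono-⊗ : ∀ a b → mono a ⊗ mono b ≋ mono (a + b)
mono-⊗ zero    b         = ⊗-identityˡ (mono b)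
mono-⊗ (suc a) b zero    = ⊗-coeff (mono (suc a)) (mono b) zero
mono-⊗ (suc a) b (suc k) =
  trans (⊗-coeff (mono (suc a)) (mono b) (suc k))
        (trans (sym (⊗-coeff (mono a) (mono b) k)) (mono-⊗ a b k))

-- [ b ]x^ d is the monomial x^d when b holds and 0 otherwise: the
-- contribution of a subset of size d passing the test b.
infix 30 [_]x^_
[_]x^_ : Bool → ℕ → Poly
[ true  ]x^ d = mono d
[ false ]x^ d = 0ₚ

[∧]x^+ : ∀ b c d e → [ b ∧ c ]x^ (d + e) ≋ [ b ]x^ d ⊗ [ c ]x^ e
[∧]x^+ true  true  d e = ≋-sym (mono-⊗ d e)
[∧]x^+ true  false d e = ≋-sym (≋-trans (⊗-comm (mono d) 0ₚ) (⊗-zeroˡ (mono d)))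
[∧]x^+ false c     d e = ≋-sym (⊗-zeroˡ ([ c ]x^ e))

sumList : {A : Set} → List A → (A → Poly) → Poly
sumList []       f = 0ₚ
sumList (x ∷ xs) f = f x ⊕ sumList xs f

sumList-cong : {A : Set} (xs : List A) {f g : A → Poly} → (∀ x → f x ≋ g x) → sumList xs f ≋ sumList xs g
sumList-cong []       f≋g = ≋-refl
sumList-cong (x ∷ xs) f≋g = ⊕-cong (f≋g x) (sumList-cong xs f≋g)

sumList-++ : {A : Set} (xs ys : List A) (f : A → Poly) →
             sumList (xs ++ₗ ys) f ≋ sumList xs f ⊕ sumList ys f
sumList-++ []       ys f k = refl
sumList-++ (x ∷ xs) ys f k = trans (cong (f x k +_) (sumList-++ xs ys f k)) (sym (+-assoc (f x k) _ _))

sumList-map : {A B : Set} (g : A → B) (xs : List A) (f : B → Poly) →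
              sumList (map g xs) f ≋ sumList xs (λ x → f (g x))
sumList-map g []       f = ≋-refl
sumList-map g (x ∷ xs) f = ⊕-cong ≋-refl (sumList-map g xs f)

sumList-⊗ʳ : {A : Set} (xs : List A) (f : A → Poly) (p : Poly) →
             sumList xs f ⊗ p ≋ sumList xs (λ x → f x ⊗ p)
sumList-⊗ʳ []       f p = ⊗-zeroˡ p
sumList-⊗ʳ (x ∷ xs) f p = ≋-trans (⊗-distribʳ (f x) (sumList xs f) p) (⊕-cong ≋-refl (sumList-⊗ʳ xs f p))

⊗-sumList : {A : Set} (xs : List A) (f : A → Poly) (p : Poly) →
            p ⊗ sumList xs f ≋ sumList xs (λ x → p ⊗ f x)
⊗-sumList xs f p = ≋-trans (⊗-comm p (sumList xs f))
  (≋-trans (sumList-⊗ʳ xs f p) (sumList-cong xs (λ x → ⊗-comm (f x) p)))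

count-as-sum : {A : Set} (size : A → ℕ) (test : A → Bool) (xs : List A) (k : ℕ) →
  length (filterᵇ (λ x → ⌊ size x ℕ.≟ k ⌋ ∧ test x) xs) ≡ sumList xs (λ x → [ test x ]x^ size x) k
count-as-sum size test []       k = refl
count-as-sum size test (x ∷ xs) k with size x ℕ.≟ k | test x
... | yes refl | true  = cong₂ _+_ (sym (mono-diag (size x))) (count-as-sum size test xs k)
... | yes refl | false = count-as-sum size test xs k
... | no  s≢k  | true  = trans (count-as-sum size test xs k) (cong (_+ _) (sym (mono-off (size x) k s≢k)))
... | no  s≢k  | false = count-as-sum size test xs k

sumSubsets : (n : ℕ) → (Vec Bool n → Poly) → Poly
sumSubsets n f = sumList (allSubsets n) f

syntax sumSubsets n (λ S → e) = ∑[ S ⊆ n ] e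

indepPoly-as-sum : ∀ {N} (a : Fin N → Fin N → Bool) →
                   indepPolyAdj a ≋ ∑[ S ⊆ N ] [ isIndependent a S ]x^ card S
indepPoly-as-sum {N} a = count-as-sum card (isIndependent a) (allSubsets N)

sumSubsets-suc : ∀ n (f : Vec Bool (suc n) → Poly) →
                 ∑[ S ⊆ suc n ] f S ≋ ∑[ S ⊆ n ] f (true ∷ S) ⊕ ∑[ S ⊆ n ] f (false ∷ S)
sumSubsets-suc n f = ≋-trans (sumList-++ (map (true ∷_) (allSubsets n)) _ f)
  (⊕-cong (sumList-map (true ∷_) (allSubsets n) f) (sumList-map (false ∷_) (allSubsets n) f))

sumSubsets-zero : ∀ n → ∑[ S ⊆ n ] 0ₚ ≋ 0ₚ
sumSubsets-zero n = go (allSubsets n)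
  where
  go : ∀ (xs : List (Vec Bool n)) → sumList xs (λ _ → 0ₚ) ≋ 0ₚ
  go []       = ≋-refl
  go (x ∷ xs) = go xs

sumSubsets-cong : ∀ n {f g : Vec Bool n → Poly} → (∀ S → f S ≋ g S) → sumSubsets n f ≋ sumSubsets n g
sumSubsets-cong n = sumList-cong (allSubsets n)

sumSubsets-++ : ∀ a b (f : Vec Bool (a + b) → Poly) →
                ∑[ S ⊆ a + b ] f S ≋ ∑[ A ⊆ a ] ∑[ B ⊆ b ] f (A ++ B)
sumSubsets-++ zero    b f k = sym (+-identityʳ _)
sumSubsets-++ (suc a) b f = begin
  ∑[ S ⊆ suc a + b ] f S
    ≈⟨ sumSubsets-suc (a + b) f ⟩
  ∑[ S ⊆ a + b ] f (true ∷ S) ⊕ ∑[ S ⊆ a + b ] f (false ∷ S)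
    ≈⟨ ⊕-cong (sumSubsets-++ a b (λ S → f (true ∷ S))) (sumSubsets-++ a b (λ S → f (false ∷ S))) ⟩
  ∑[ A ⊆ a ] ∑[ B ⊆ b ] f (true ∷ A ++ B) ⊕ ∑[ A ⊆ a ] ∑[ B ⊆ b ] f (false ∷ A ++ B)
    ≈⟨ sumSubsets-suc a (λ A → ∑[ B ⊆ b ] f (A ++ B)) ⟨
  ∑[ A ⊆ suc a ] ∑[ B ⊆ b ] f (A ++ B) ∎
  where open ≋-Reasoning

sumSubsets-⊗ : ∀ a b (f : Vec Bool a → Poly) (g : Vec Bool b → Poly) →
               ∑[ A ⊆ a ] ∑[ B ⊆ b ] (f A ⊗ g B) ≋ sumSubsets a f ⊗ sumSubsets b g
sumSubsets-⊗ a b f g = ≋-trans (sumSubsets-cong a (λ A → ≋-sym (⊗-sumList (allSubsets b) g (f A))))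
                               (≋-sym (sumList-⊗ʳ (allSubsets a) f (sumSubsets b g)))

sumTuples : ∀ q k → (Vec (Vec Bool k) q → Poly) → Poly
sumTuples zero    k f = f []
sumTuples (suc q) k f = ∑[ B ⊆ k ] sumTuples q k (λ Bs → f (B ∷ Bs))

sumTuples-cong : ∀ q k {f g : Vec (Vec Bool k) q → Poly} → (∀ Bs → f Bs ≋ g Bs) →
                 sumTuples q k f ≋ sumTuples q k g
sumTuples-cong zero    k f≋g = f≋g []
sumTuples-cong (suc q) k f≋g = sumSubsets-cong k (λ B → sumTuples-cong q k (λ Bs → f≋g (B ∷ Bs)))

sumSubsets-concat : ∀ q k (f : Vec Bool (q * k) → Poly) →
                    ∑[ T ⊆ q * k ] f T ≋ sumTuples q k (λ Bs → f (concat Bs))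
sumSubsets-concat zero    k f t = +-identityʳ (f [] t)
sumSubsets-concat (suc q) k f = ≋-trans (sumSubsets-++ k (q * k) f)
  (sumSubsets-cong k (λ B → sumSubsets-concat q k (λ T → f (B ++ T))))

⊗-sumTuples : ∀ q k (p : Poly) (f : Vec (Vec Bool k) q → Poly) →
              p ⊗ sumTuples q k f ≋ sumTuples q k (λ Bs → p ⊗ f Bs)
⊗-sumTuples zero    k p f = ≋-refl
⊗-sumTuples (suc q) k p f = ≋-trans (⊗-sumList (allSubsets k) _ p)
  (sumSubsets-cong k (λ B → ⊗-sumTuples q k p (λ Bs → f (B ∷ Bs))))

sumTuples-∏ : ∀ q k (g : Fin q → Vec Bool k → Poly) →
              sumTuples q k (λ Bs → ∏ (λ i → g i (lookup Bs i))) ≋ ∏ (λ i → ∑[ B ⊆ k ] g i B)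
sumTuples-∏ zero    k g = ≋-refl
sumTuples-∏ (suc q) k g = begin
  ∑[ B ⊆ k ] sumTuples q k (λ Bs → g zero B ⊗ ∏ (λ i → g (suc i) (lookup Bs i)))
    ≈⟨ sumSubsets-cong k (λ B → ⊗-sumTuples q k (g zero B) (λ Bs → ∏ (λ i → g (suc i) (lookup Bs i)))) ⟨
  ∑[ B ⊆ k ] (g zero B ⊗ sumTuples q k (λ Bs → ∏ (λ i → g (suc i) (lookup Bs i))))
    ≈⟨ sumSubsets-cong k (λ B → ⊗-congˡ (g zero B) (sumTuples-∏ q k (λ i → g (suc i)))) ⟩
  ∑[ B ⊆ k ] (g zero B ⊗ ∏ (λ i → ∑[ B′ ⊆ k ] g (suc i) B′))
    ≈⟨ sumList-⊗ʳ (allSubsets k) (g zero) _ ⟨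
  ∏ (λ i → ∑[ B ⊆ k ] g i B) ∎
  where open ≋-Reasoning

card-++ : ∀ {a b} (A : Vec Bool a) (B : Vec Bool b) → card (A ++ B) ≡ card A + card B
card-++ []          B = refl
card-++ (true ∷ A)  B = cong suc (card-++ A B)
card-++ (false ∷ A) B = card-++ A B

⋀ : ∀ q → (Fin q → Bool) → Bool
⋀ zero    b = true
⋀ (suc q) b = b zero ∧ ⋀ q (λ i → b (suc i))

[⋀]x^concat : ∀ q {k} (test : Fin q → Vec Bool k → Bool) (Bs : Vec (Vec Bool k) q) →
  [ ⋀ q (λ i → test i (lookup Bs i)) ]x^ card (concat Bs) ≋ ∏ (λ i → [ test i (lookup Bs i) ]x^ card (lookup Bs i))
[⋀]x^concat zero    test []       = ≋-refl
[⋀]x^concat (suc q) test (B ∷ Bs) = begin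
  [ test zero B ∧ ⋀ q (λ i → test (suc i) (lookup Bs i)) ]x^ card (B ++ concat Bs)
    ≡⟨ cong ([ test zero B ∧ ⋀ q (λ i → test (suc i) (lookup Bs i)) ]x^_) (card-++ B (concat Bs)) ⟩
  [ test zero B ∧ ⋀ q (λ i → test (suc i) (lookup Bs i)) ]x^ (card B + card (concat Bs))
    ≈⟨ [∧]x^+ (test zero B) _ (card B) (card (concat Bs)) ⟩
  [ test zero B ]x^ card B ⊗ [ ⋀ q (λ i → test (suc i) (lookup Bs i)) ]x^ card (concat Bs)
    ≈⟨ ⊗-congˡ ([ test zero B ]x^ card B) ([⋀]x^concat q (λ i → test (suc i)) Bs) ⟩
  ∏ (λ i → [ test i (lookup (B ∷ Bs) i) ]x^ card (lookup (B ∷ Bs) i)) ∎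
  where open ≋-Reasoning

-- For irreflexive a this is
-- the usual notion (a vertex is never adjacent to itself).
Independent : {V : Set} → (V → V → Bool) → (V → Bool) → Set
Independent a P = ∀ u v → P u ≡ true → P v ≡ true → a u v ≡ false

Irreflexive : {V : Set} → (V → V → Bool) → Set
Irreflexive a = ∀ u → a u u ≡ false

all-allFin : ∀ {n} (p : Fin n → Bool) → all p (allFin n) ≡ true ⇔ (∀ i → p i ≡ true)
all-allFin {n} p = mk⇔
  (λ holds i → to T-≡ (All.lookup (all⁺ p (allFin n) (from T-≡ holds)) (∈-allFin i)))
  (λ each → to T-≡ (all⁻ p (tabulate⁺ (λ i → from T-≡ (each i)))))

isIndependent⇔ : ∀ {N} {a : Fin N → Fin N → Bool} → Irreflexive a →
                 ∀ S → isIndependent a S ≡ true ⇔ Independent a (lookup S)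
isIndependent⇔ {N} {a} irrefl S = mk⇔
  (λ test u v Su Sv → sound u v Su Sv (to (all-allFin _) (to (all-allFin _) test u) v))
  (λ ind → from (all-allFin _) (λ u → from (all-allFin _) (λ v → complete ind u v)))
  where
  pairTest : Fin N → Fin N → Bool
  pairTest u v = not (lookup S u ∧ lookup S v ∧ not ⌊ u ≟ v ⌋ ∧ a u v)

  sound : ∀ u v → lookup S u ≡ true → lookup S v ≡ true → pairTest u v ≡ true → a u v ≡ false
  sound u v Su Sv test with u ≟ v
  ... | yes refl = irrefl u
  ... | no  _ rewrite Su | Sv = trans (sym (not-involutive (a u v))) (cong not test)

  complete : Independent a (lookup S) → ∀ u v → pairTest u v ≡ true
  complete ind u v with lookup S u in Su | lookup S v in Sv
  ... | false | _     = refl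
  ... | true  | false = refl
  ... | true  | true  rewrite ind u v Su Sv = cong not (∧-zeroʳ (not ⌊ u ≟ v ⌋))

Independent-transfer : {W V : Set} (dec : W → V) (enc : V → W) → (∀ v → dec (enc v) ≡ v) →
  ∀ {a : W → W → Bool} {a′ : V → V → Bool} {P : W → Bool} {P′ : V → Bool} →
  (∀ x y → a x y ≡ a′ (dec x) (dec y)) → (∀ x → P x ≡ P′ (dec x)) →
  Independent a P ⇔ Independent a′ P′
Independent-transfer dec enc dec-enc {a} {a′} {P} {P′} a≐a′ P≐P′ = mk⇔
  (λ ind u v P′u P′v → begin
     a′ u v                         ≡⟨ cong₂ a′ (dec-enc u) (dec-enc v) ⟨
     a′ (dec (enc u)) (dec (enc v)) ≡⟨ a≐a′ (enc u) (enc v) ⟨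
     a (enc u) (enc v)              ≡⟨ ind (enc u) (enc v) (member u P′u) (member v P′v) ⟩
     false                          ∎)
  (λ ind′ x y Px Py → trans (a≐a′ x y)
                             (ind′ (dec x) (dec y) (trans (sym (P≐P′ x)) Px) (trans (sym (P≐P′ y)) Py)))
  where
  open ≡-Reasoning
  member : ∀ v → P′ v ≡ true → P (enc v) ≡ true
  member v P′v = trans (P≐P′ (enc v)) (trans (cong P′ (dec-enc v)) P′v)

indepPolyAdj-cong : ∀ {N} {a b : Fin N → Fin N → Bool} → (∀ x y → a x y ≡ b x y) →
                    indepPolyAdj a ≋ indepPolyAdj b
indepPolyAdj-cong {N} {a} {b} a≐b = ≋-trans (indepPoly-as-sum a)
  (≋-trans (sumSubsets-cong N (λ S k → cong (λ t → ([ t ]x^ card S) k) (same-test S)))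
           (≋-sym (indepPoly-as-sum b)))
  where
  same-test : ∀ S → isIndependent a S ≡ isIndependent b S
  same-test S = cong and (map-cong (λ u → cong and
    (map-cong (λ v → cong (λ t → not (lookup S u ∧ lookup S v ∧ not ⌊ u ≟ v ⌋ ∧ t)) (a≐b u v)) (allFin N)))
    (allFin N))

⋀⇔ : ∀ q (b : Fin q → Bool) → ⋀ q b ≡ true ⇔ (∀ i → b i ≡ true)
⋀⇔ q b = mk⇔ (fwd q b) (bwd q b)
  where
  fwd : ∀ q (b : Fin q → Bool) → ⋀ q b ≡ true → ∀ i → b i ≡ true
  fwd (suc q) b holds zero    = ∧-conicalˡ _ _ holds
  fwd (suc q) b holds (suc i) = fwd q (λ j → b (suc j)) (∧-conicalʳ (b zero) _ holds) i
  bwd : ∀ q (b : Fin q → Bool) → (∀ i → b i ≡ true) → ⋀ q b ≡ true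
  bwd zero    b each = refl
  bwd (suc q) b each = cong₂ _∧_ (each zero) (bwd q (λ j → b (suc j)) (λ j → each (suc j)))

∧⇔ : ∀ {b c} → b ∧ c ≡ true ⇔ (b ≡ true × c ≡ true)
∧⇔ {b} {c} = mk⇔ (λ bc → ∧-conicalˡ b c bc , ∧-conicalʳ b c bc) (λ (b≡t , c≡t) → cong₂ _∧_ b≡t c≡t)

isEmpty : ∀ {k} → Vec Bool k → Bool
isEmpty []      = true
isEmpty (b ∷ B) = not b ∧ isEmpty B

isEmpty⇒ : ∀ {k} (B : Vec Bool k) → isEmpty B ≡ true → ∀ y → lookup B y ≡ false
isEmpty⇒ (false ∷ B) empty zero    = refl
isEmpty⇒ (false ∷ B) empty (suc y) = isEmpty⇒ B empty y

⇒isEmpty : ∀ {k} (B : Vec Bool k) → (∀ y → lookup B y ≡ false) → isEmpty B ≡ true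
⇒isEmpty []      none = refl
⇒isEmpty (b ∷ B) none rewrite none zero = ⇒isEmpty B (λ y → none (suc y))

sum-isEmpty : ∀ k → ∑[ B ⊆ k ] [ isEmpty B ]x^ card B ≋ one
sum-isEmpty zero    t = +-identityʳ (one t)
sum-isEmpty (suc k) = ≋-trans (sumSubsets-suc k (λ B → [ isEmpty B ]x^ card B))
                              (⊕-cong (sumSubsets-zero k) (sum-isEmpty k))

true≢false : true ≢ false
true≢false ()

⌊≟⌋-refl : ∀ {n} (i : Fin n) → ⌊ i ≟ i ⌋ ≡ true
⌊≟⌋-refl i = trans (isYes≗does (i ≟ i)) (dec-true (i ≟ i) refl)

-- The vertices are those of a base graph on Fin n
-- (adjacency aG) together with q disjoint copies of a block graph on Fin k
-- (adjacency aK); base vertex u is joined to every vertex of copy i exactly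
-- when att i u holds.
module PendantGraph {n q k : ℕ} (aG : Fin n → Fin n → Bool) (aK : Fin k → Fin k → Bool)
                    (att : Fin q → Fin n → Bool) where

  Vertex : Set
  Vertex = Fin n ⊎ (Fin q × Fin k)

  pendAdj : Vertex → Vertex → Bool
  pendAdj (inj₁ u)       (inj₁ v)       = aG u v
  pendAdj (inj₁ u)       (inj₂ (i , _)) = att i u
  pendAdj (inj₂ (i , _)) (inj₁ u)       = att i u
  pendAdj (inj₂ (i , x)) (inj₂ (j , y)) = ⌊ i ≟ j ⌋ ∧ aK x y

  decode : Fin (n + q * k) → Vertex
  decode x = Sum.map₂ (remQuot k) (splitAt n x)

  encode : Vertex → Fin (n + q * k)
  encode v = join n (q * k) (Sum.map₂ (uncurry combine) v)

  decode-encode : ∀ v → decode (encode v) ≡ v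
  decode-encode v rewrite splitAt-join n (q * k) (Sum.map₂ (uncurry combine) v) with v
  ... | inj₁ u       = refl
  ... | inj₂ (i , y) = cong inj₂ (remQuot-combine i y)

  pendantAdj : Fin (n + q * k) → Fin (n + q * k) → Bool
  pendantAdj x y = pendAdj (decode x) (decode y)

  member : Vec Bool n → Vec (Vec Bool k) q → Vertex → Bool
  member SG Bs (inj₁ u)       = lookup SG u
  member SG Bs (inj₂ (i , y)) = lookup (lookup Bs i) y

  lookup-member : ∀ SG Bs x → lookup (SG ++ concat Bs) x ≡ member SG Bs (decode x)
  lookup-member SG Bs x rewrite lookup-splitAt n SG (concat Bs) x with splitAt n x
  ... | inj₁ u = refl
  ... | inj₂ y = trans (cong (lookup (concat Bs)) (sym (combine-remQuot {q} k y)))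
                       (lookup-concat Bs (proj₁ (remQuot {q} k y)) (proj₂ (remQuot {q} k y)))

  -- The condition on the part B of an independent set inside one block:
  -- empty if the block is hit by the base part, independent otherwise.
  blockOK : Bool → Vec Bool k → Bool
  blockOK true  B = isEmpty B
  blockOK false B = isIndependent aK B

  block-sum : ∀ hit → ∑[ B ⊆ k ] [ blockOK hit B ]x^ card B ≋ (if hit then one else indepPolyAdj aK)
  block-sum true  = sum-isEmpty k
  block-sum false = ≋-sym (indepPoly-as-sum aK)

  module _ (aG-irrefl : Irreflexive aG) (aK-irrefl : Irreflexive aK)
           (hit : Vec Bool n → Fin q → Bool)
           (hit-spec : ∀ S i → hit S i ≡ false ⇔ (∀ u → lookup S u ≡ true → att i u ≡ false)) where

    partsOK : Vec Bool n → Vec (Vec Bool k) q → Bool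
    partsOK SG Bs = isIndependent aG SG ∧ ⋀ q (λ i → blockOK (hit SG i) (lookup Bs i))

    independent⇒partsOK : ∀ SG Bs → Independent pendAdj (member SG Bs) → partsOK SG Bs ≡ true
    independent⇒partsOK SG Bs ind =
      from ∧⇔ (from (isIndependent⇔ aG-irrefl SG) (λ u v → ind (inj₁ u) (inj₁ v)) , from (⋀⇔ q _) block-ok)
      where
      absent : ∀ i → hit SG i ≡ true → ∀ y → lookup (lookup Bs i) y ≡ false
      absent i hit≡ y with lookup (lookup Bs i) y in present
      ... | false = refl
      ... | true  = ⊥-elim (true≢false (trans (sym hit≡)
                      (from (hit-spec SG i) (λ u Su → ind (inj₁ u) (inj₂ (i , y)) Su present))))

      block-ok : ∀ i → blockOK (hit SG i) (lookup Bs i) ≡ true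
      block-ok i with hit SG i in hit≡
      ... | true  = ⇒isEmpty (lookup Bs i) (absent i hit≡)
      ... | false = from (isIndependent⇔ aK-irrefl (lookup Bs i)) (λ x y Bx By →
                      trans (cong (_∧ aK x y) (sym (⌊≟⌋-refl i))) (ind (inj₂ (i , x)) (inj₂ (i , y)) Bx By))

    partsOK⇒independent : ∀ SG Bs → partsOK SG Bs ≡ true → Independent pendAdj (member SG Bs)
    partsOK⇒independent SG Bs holds = ind
      where
      base : Independent aG (lookup SG)
      base = to (isIndependent⇔ aG-irrefl SG) (proj₁ (to ∧⇔ holds))

      blocks : ∀ i → blockOK (hit SG i) (lookup Bs i) ≡ true
      blocks = to (⋀⇔ q _) (proj₂ (to ∧⇔ holds))

      unhit : ∀ i y → lookup (lookup Bs i) y ≡ true → hit SG i ≡ false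
      unhit i y present with hit SG i in hit≡
      ... | false = refl
      ... | true  = ⊥-elim (true≢false (trans (sym present)
                      (isEmpty⇒ (lookup Bs i) (subst (λ h → blockOK h (lookup Bs i) ≡ true) hit≡ (blocks i)) y)))

      attached-free : ∀ u i y → lookup SG u ≡ true → lookup (lookup Bs i) y ≡ true → att i u ≡ false
      attached-free u i y Su present = to (hit-spec SG i) (unhit i y present) u Su

      block : ∀ i y → lookup (lookup Bs i) y ≡ true → Independent aK (lookup (lookup Bs i))
      block i y present = to (isIndependent⇔ aK-irrefl (lookup Bs i))
                             (subst (λ h → blockOK h (lookup Bs i) ≡ true) (unhit i y present) (blocks i))

      ind : Independent pendAdj (member SG Bs)
      ind (inj₁ u)       (inj₁ v)       Su Sv = base u v Su Sv
      ind (inj₁ u)       (inj₂ (i , y)) Su By = attached-free u i y Su By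
      ind (inj₂ (i , y)) (inj₁ u)       By Su = attached-free u i y Su By
      ind (inj₂ (i , x)) (inj₂ (j , y)) Bx By with i ≟ j
      ... | no  _    = refl
      ... | yes refl = block i x Bx x y Bx By

    pendAdj-irrefl : Irreflexive pendAdj
    pendAdj-irrefl (inj₁ u)       = aG-irrefl u
    pendAdj-irrefl (inj₂ (i , x)) rewrite aK-irrefl x = ∧-zeroʳ _

    pendant-independent : ∀ SG Bs → isIndependent pendantAdj (SG ++ concat Bs) ≡ partsOK SG Bs
    pendant-independent SG Bs = ⇔→≡ (⇔-trans decide (⇔-trans relabel split))
      where
      decide : isIndependent pendantAdj (SG ++ concat Bs) ≡ true ⇔ Independent pendantAdj (lookup (SG ++ concat Bs))
      decide = isIndependent⇔ (λ x → pendAdj-irrefl (decode x)) (SG ++ concat Bs)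
      relabel : Independent pendantAdj (lookup (SG ++ concat Bs)) ⇔ Independent pendAdj (member SG Bs)
      relabel = Independent-transfer decode encode decode-encode (λ x y → refl) (lookup-member SG Bs)
      split : Independent pendAdj (member SG Bs) ⇔ partsOK SG Bs ≡ true
      split = mk⇔ (independent⇒partsOK SG Bs) (partsOK⇒independent SG Bs)

    pendant-term : ∀ SG Bs →
      [ isIndependent pendantAdj (SG ++ concat Bs) ]x^ card (SG ++ concat Bs) ≋
      [ isIndependent aG SG ]x^ card SG ⊗ ∏ (λ i → [ blockOK (hit SG i) (lookup Bs i) ]x^ card (lookup Bs i))
    pendant-term SG Bs = begin
      [ isIndependent pendantAdj (SG ++ concat Bs) ]x^ card (SG ++ concat Bs)
        ≡⟨ cong₂ [_]x^_ (pendant-independent SG Bs) (card-++ SG (concat Bs)) ⟩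
      [ isIndependent aG SG ∧ ⋀ q (λ i → blockOK (hit SG i) (lookup Bs i)) ]x^ (card SG + card (concat Bs))
        ≈⟨ [∧]x^+ (isIndependent aG SG) _ (card SG) (card (concat Bs)) ⟩
      [ isIndependent aG SG ]x^ card SG ⊗ [ ⋀ q (λ i → blockOK (hit SG i) (lookup Bs i)) ]x^ card (concat Bs)
        ≈⟨ ⊗-congˡ ([ isIndependent aG SG ]x^ card SG) ([⋀]x^concat q (λ i → blockOK (hit SG i)) Bs) ⟩
      [ isIndependent aG SG ]x^ card SG ⊗ ∏ (λ i → [ blockOK (hit SG i) (lookup Bs i) ]x^ card (lookup Bs i)) ∎
      where open ≋-Reasoning

    pendant-indepPoly : indepPolyAdj pendantAdj ≋
      ∑[ S ⊆ n ] ([ isIndependent aG S ]x^ card S ⊗ ∏ (λ i → if hit S i then one else indepPolyAdj aK))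
    pendant-indepPoly = begin
      indepPolyAdj pendantAdj
        ≈⟨ indepPoly-as-sum pendantAdj ⟩
      ∑[ S ⊆ n + q * k ] [ isIndependent pendantAdj S ]x^ card S
        ≈⟨ sumSubsets-++ n (q * k) _ ⟩
      ∑[ SG ⊆ n ] ∑[ T ⊆ q * k ] [ isIndependent pendantAdj (SG ++ T) ]x^ card (SG ++ T)
        ≈⟨ sumSubsets-cong n (λ SG → sumSubsets-concat q k _) ⟩
      ∑[ SG ⊆ n ] sumTuples q k (λ Bs → [ isIndependent pendantAdj (SG ++ concat Bs) ]x^ card (SG ++ concat Bs))
        ≈⟨ sumSubsets-cong n (λ SG → sumTuples-cong q k (pendant-term SG)) ⟩
      ∑[ SG ⊆ n ] sumTuples q k (λ Bs → base SG ⊗ ∏ (λ i → block SG i (lookup Bs i)))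
        ≈⟨ sumSubsets-cong n (λ SG → ⊗-sumTuples q k (base SG) (λ Bs → ∏ (λ i → block SG i (lookup Bs i)))) ⟨
      ∑[ SG ⊆ n ] (base SG ⊗ sumTuples q k (λ Bs → ∏ (λ i → block SG i (lookup Bs i))))
        ≈⟨ sumSubsets-cong n (λ SG → ⊗-congˡ (base SG) (sumTuples-∏ q k (block SG))) ⟩
      ∑[ SG ⊆ n ] (base SG ⊗ ∏ (λ i → ∑[ B ⊆ k ] block SG i B))
        ≈⟨ sumSubsets-cong n (λ SG → ⊗-congˡ (base SG) (∏-cong (λ i → block-sum (hit SG i)))) ⟩
      ∑[ SG ⊆ n ] (base SG ⊗ ∏ (λ i → if hit SG i then one else indepPolyAdj aK)) ∎
      where
      open ≋-Reasoning
      base : Vec Bool n → Poly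
      base SG = [ isIndependent aG SG ]x^ card SG
      block : Vec Bool n → Fin q → Vec Bool k → Poly
      block SG i B = [ blockOK (hit SG i) B ]x^ card B

module DisjointUnion {a b : ℕ} (aA : Fin a → Fin a → Bool) (aB : Fin b → Fin b → Bool) where

  ⊎Adj : Fin a ⊎ Fin b → Fin a ⊎ Fin b → Bool
  ⊎Adj (inj₁ u) (inj₁ v) = aA u v
  ⊎Adj (inj₂ u) (inj₂ v) = aB u v
  ⊎Adj (inj₁ _) (inj₂ _) = false
  ⊎Adj (inj₂ _) (inj₁ _) = false

  unionAdj : Fin (a + b) → Fin (a + b) → Bool
  unionAdj x y = ⊎Adj (splitAt a x) (splitAt a y)

  module _ (aA-irrefl : Irreflexive aA) (aB-irrefl : Irreflexive aB) where

    unionAdj-irrefl : Irreflexive unionAdj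
    unionAdj-irrefl x with splitAt a x
    ... | inj₁ u = aA-irrefl u
    ... | inj₂ v = aB-irrefl v

    union-independent : ∀ A B → isIndependent unionAdj (A ++ B) ≡ isIndependent aA A ∧ isIndependent aB B
    union-independent A B = ⇔→≡ (⇔-trans decide (⇔-trans relabel split))
      where
      decide : isIndependent unionAdj (A ++ B) ≡ true ⇔ Independent unionAdj (lookup (A ++ B))
      decide = isIndependent⇔ unionAdj-irrefl (A ++ B)
      relabel : Independent unionAdj (lookup (A ++ B)) ⇔ Independent ⊎Adj [ lookup A , lookup B ]′
      relabel = Independent-transfer (splitAt a) (join a b) (splitAt-join a b) (λ x y → refl) (lookup-splitAt a A B)
      parts : Independent aA (lookup A) → Independent aB (lookup B) →
              Independent ⊎Adj [ lookup A , lookup B ]′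
      parts indA indB (inj₁ u) (inj₁ v) = indA u v
      parts indA indB (inj₂ u) (inj₂ v) = indB u v
      parts indA indB (inj₁ _) (inj₂ _) _ _ = refl
      parts indA indB (inj₂ _) (inj₁ _) _ _ = refl
      split : Independent ⊎Adj [ lookup A , lookup B ]′ ⇔ (isIndependent aA A ∧ isIndependent aB B) ≡ true
      split = mk⇔
        (λ ind → from ∧⇔ (from (isIndependent⇔ aA-irrefl A) (λ u v → ind (inj₁ u) (inj₁ v)) ,
                          from (isIndependent⇔ aB-irrefl B) (λ u v → ind (inj₂ u) (inj₂ v))))
        (λ holds → parts (to (isIndependent⇔ aA-irrefl A) (proj₁ (to ∧⇔ holds)))
                         (to (isIndependent⇔ aB-irrefl B) (proj₂ (to ∧⇔ holds))))

    union-indepPoly : indepPolyAdj unionAdj ≋ indepPolyAdj aA ⊗ indepPolyAdj aB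
    union-indepPoly = begin
      indepPolyAdj unionAdj
        ≈⟨ indepPoly-as-sum unionAdj ⟩
      ∑[ S ⊆ a + b ] [ isIndependent unionAdj S ]x^ card S
        ≈⟨ sumSubsets-++ a b _ ⟩
      ∑[ A ⊆ a ] ∑[ B ⊆ b ] [ isIndependent unionAdj (A ++ B) ]x^ card (A ++ B)
        ≈⟨ sumSubsets-cong a (λ A → sumSubsets-cong b (λ B → split-term A B)) ⟩
      ∑[ A ⊆ a ] ∑[ B ⊆ b ] ([ isIndependent aA A ]x^ card A ⊗ [ isIndependent aB B ]x^ card B)
        ≈⟨ sumSubsets-⊗ a b _ _ ⟩
      (∑[ A ⊆ a ] [ isIndependent aA A ]x^ card A) ⊗ (∑[ B ⊆ b ] [ isIndependent aB B ]x^ card B)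
        ≈⟨ ⊗-cong (≋-sym (indepPoly-as-sum aA)) (≋-sym (indepPoly-as-sum aB)) ⟩
      indepPolyAdj aA ⊗ indepPolyAdj aB ∎
      where
      open ≋-Reasoning
      split-term : ∀ A B → [ isIndependent unionAdj (A ++ B) ]x^ card (A ++ B) ≋
                           [ isIndependent aA A ]x^ card A ⊗ [ isIndependent aB B ]x^ card B
      split-term A B = ≋-trans (≡⇒≋ (cong₂ [_]x^_ (union-independent A B) (card-++ A B)))
                               ([∧]x^+ (isIndependent aA A) (isIndependent aB B) (card A) (card B))

^^-as-∏ : ∀ q p → p ^^ q ≋ ∏ {q} (λ _ → p)
^^-as-∏ zero    p = ≋-refl
^^-as-∏ (suc q) p = ⊗-congˡ p (^^-as-∏ q p)

nextIdx-inject₁ : ∀ {q} (i : Fin q) → nextIdx (inject₁ i) ≡ suc i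
nextIdx-inject₁ {q} i = toℕ-injective (begin
  toℕ (nextIdx (inject₁ i)) ≡⟨ toℕ-fromℕ< _ ⟩
  suc (toℕ (inject₁ i)) % suc q ≡⟨ m<n⇒m%n≡m (s≤s (subst (_< q) (sym (toℕ-inject₁ i)) (toℕ<n i))) ⟩
  suc (toℕ (inject₁ i)) ≡⟨ cong suc (toℕ-inject₁ i) ⟩
  suc (toℕ i) ∎)
  where open ≡-Reasoning

nextIdx-last : ∀ q → nextIdx (fromℕ q) ≡ zero
nextIdx-last q = toℕ-injective (begin
  toℕ (nextIdx (fromℕ q))       ≡⟨ toℕ-fromℕ< _ ⟩
  suc (toℕ (fromℕ q)) % suc q   ≡⟨ cong (λ m → suc m % suc q) (toℕ-fromℕ q) ⟩
  suc q % suc q                 ≡⟨ n%n≡0 (suc q) ⟩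
  0 ∎)
  where open ≡-Reasoning

∏-rotate : ∀ q (f : Fin (suc q) → Poly) → ∏ (λ i → f (nextIdx i)) ≋ ∏ f
∏-rotate q f = begin
  ∏ (λ i → f (nextIdx i))                                   ≈⟨ ∏-init-last (λ i → f (nextIdx i)) ⟩
  ∏ (λ i → f (nextIdx (inject₁ i))) ⊗ f (nextIdx (fromℕ q)) ≈⟨ ⊗-cong (∏-cong (λ i → ≡⇒≋ (cong f (nextIdx-inject₁ i))))
                                                                       (≡⇒≋ (cong f (nextIdx-last q))) ⟩
  ∏ (λ i → f (suc i)) ⊗ f zero                              ≈⟨ ⊗-comm (∏ (λ i → f (suc i))) (f zero) ⟩
  ∏ f                                                       ∎
  where open ≋-Reasoning

-- Let a mark positions on a cycle of length q+1 with no
-- two cyclically consecutive marked.  Writing f i = (1 if a i else P), the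
-- factor (1 if a i or a (i+1) else P) times P equals f i · f (i+1), so
--   P^(q+1) · ∏_i (1 if a i ∨ a (i+1) else P) = ∏_i f i · ∏_i f (i+1) = ∏_i f i².
cycle-identity : ∀ q (P : Poly) (a : Fin (suc q) → Bool) → (∀ i → a i ∧ a (nextIdx i) ≡ false) →
  (P ^^ suc q) ⊗ ∏ (λ i → if a i ∨ a (nextIdx i) then one else P) ≋ ∏ (λ i → if a i then one else P ⊗ P)
cycle-identity q P a apart = begin
  (P ^^ suc q) ⊗ ∏ edge                     ≈⟨ ⊗-congʳ (∏ edge) (^^-as-∏ (suc q) P) ⟩
  ∏ {suc q} (λ _ → P) ⊗ ∏ edge              ≈⟨ ∏-distrib-⊗ (λ _ → P) edge ⟨
  ∏ (λ i → P ⊗ edge i)                      ≈⟨ ∏-cong edge-split ⟩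
  ∏ (λ i → f i ⊗ f (nextIdx i))             ≈⟨ ∏-distrib-⊗ f (λ i → f (nextIdx i)) ⟩
  ∏ f ⊗ ∏ (λ i → f (nextIdx i))             ≈⟨ ⊗-congˡ (∏ f) (∏-rotate q f) ⟩
  ∏ f ⊗ ∏ f                                 ≈⟨ ∏-distrib-⊗ f f ⟨
  ∏ (λ i → f i ⊗ f i)                       ≈⟨ ∏-cong square ⟩
  ∏ (λ i → if a i then one else P ⊗ P)      ∎
  where
  open ≋-Reasoning
  edge : Fin (suc q) → Poly
  edge i = if a i ∨ a (nextIdx i) then one else P
  f : Fin (suc q) → Poly
  f i = if a i then one else P

  edge-split : ∀ i → P ⊗ edge i ≋ f i ⊗ f (nextIdx i)
  edge-split i with a i | a (nextIdx i) | apart i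
  ... | false | false | _ = ≋-refl
  ... | false | true  | _ = ≋-refl
  ... | true  | false | _ = ⊗-comm P one

  square : ∀ i → f i ⊗ f i ≋ (if a i then one else P ⊗ P)
  square i with a i
  ... | true  = ⊗-identityˡ one
  ... | false = ≋-refl

[]x^-guard : ∀ b d {X Y} → (b ≡ true → X ≋ Y) → [ b ]x^ d ⊗ X ≋ [ b ]x^ d ⊗ Y
[]x^-guard true  d X≋Y = ⊗-congˡ (mono d) (X≋Y refl)
[]x^-guard false d {X} {Y} X≋Y = ≋-trans (⊗-zeroˡ X) (≋-sym (⊗-zeroˡ Y))

avoids⇔ : ∀ {n} (S : Vec Bool n) v → lookup S v ≡ false ⇔ (∀ u → lookup S u ≡ true → ⌊ u ≟ v ⌋ ≡ false)
avoids⇔ S v = mk⇔ avoid (λ others → not-member others)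
  where
  avoid : lookup S v ≡ false → ∀ u → lookup S u ≡ true → ⌊ u ≟ v ⌋ ≡ false
  avoid Sv u Su with u ≟ v
  ... | yes refl = trans (sym Su) Sv
  ... | no  _    = refl
  not-member : (∀ u → lookup S u ≡ true → ⌊ u ≟ v ⌋ ≡ false) → lookup S v ≡ false
  not-member others with lookup S v in Sv
  ... | false = refl
  ... | true  = trans (sym (⌊≟⌋-refl v)) (others v Sv)

avoids-both⇔ : ∀ {n} (S : Vec Bool n) v w → (lookup S v ∨ lookup S w) ≡ false ⇔
               (∀ u → lookup S u ≡ true → (⌊ u ≟ v ⌋ ∨ ⌊ u ≟ w ⌋) ≡ false)
avoids-both⇔ S v w = mk⇔
  (λ none u Su → cong₂ _∨_ (to (avoids⇔ S v) (∨-conicalˡ (lookup S v) _ none) u Su)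
                            (to (avoids⇔ S w) (∨-conicalʳ _ (lookup S w) none) u Su))
  (λ others → cong₂ _∨_ (from (avoids⇔ S v) (λ u Su → ∨-conicalˡ ⌊ u ≟ v ⌋ _ (others u Su)))
                        (from (avoids⇔ S w) (λ u Su → ∨-conicalʳ _ ⌊ u ≟ w ⌋ (others u Su))))

module Constructions (G : Graph) (C : Cycle G) (H : Graph) where
  private
    n q m : ℕ
    n = size G
    q = ∣ C ∣C
    m = size H
    c : Fin q → Fin n
    c = vtx C

  open DisjointUnion (adj H) (adj H) using (unionAdj; union-indepPoly)

  module Corona = PendantGraph {n} {q} {m + m} (adj G) unionAdj (λ i u → ⌊ u ≟ c i ⌋)

  corona-is-pendant : ∀ x y → coronaAdj G C H x y ≡ Corona.pendantAdj x y
  corona-is-pendant x y with splitAt n x | splitAt n y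
  ... | inj₁ u  | inj₁ v  = refl
  ... | inj₁ u  | inj₂ y′ = refl
  ... | inj₂ x′ | inj₁ v  = refl
  ... | inj₂ x′ | inj₂ y′
    with splitAt m (proj₂ (remQuot {q} (m + m) x′)) | splitAt m (proj₂ (remQuot {q} (m + m) y′))
  ...     | inj₁ _ | inj₁ _ = refl
  ...     | inj₂ _ | inj₂ _ = refl
  ...     | inj₁ _ | inj₂ _ = sym (∧-zeroʳ _)
  ...     | inj₂ _ | inj₁ _ = sym (∧-zeroʳ _)

  module Triangle = PendantGraph {n} {q} {m} (adj G) (adj H) (λ i u → ⌊ u ≟ c i ⌋ ∨ ⌊ u ≟ c (nextIdx i) ⌋)

  triangle-is-pendant : ∀ x y → triAdj G C H x y ≡ Triangle.pendantAdj x y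
  triangle-is-pendant x y with splitAt n x | splitAt n y
  ... | inj₁ _ | inj₁ _ = refl
  ... | inj₁ _ | inj₂ _ = refl
  ... | inj₂ _ | inj₁ _ = refl
  ... | inj₂ _ | inj₂ _ = refl

  corona-indepPoly : I-corona G C H ≋
    ∑[ S ⊆ n ] ([ isIndependent (adj G) S ]x^ card S ⊗ ∏ (λ i → if lookup S (c i) then one else I H ⊗ I H))
  corona-indepPoly = begin
    I-corona G C H
      ≈⟨ indepPolyAdj-cong corona-is-pendant ⟩
    indepPolyAdj Corona.pendantAdj
      ≈⟨ Corona.pendant-indepPoly (irrefl G) (DisjointUnion.unionAdj-irrefl (adj H) (adj H) (irrefl H) (irrefl H))
           (λ S i → lookup S (c i)) (λ S i → avoids⇔ S (c i)) ⟩
    ∑[ S ⊆ n ] ([ isIndependent (adj G) S ]x^ card S ⊗ ∏ (λ i → if lookup S (c i) then one else indepPolyAdj unionAdj))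
      ≈⟨ sumSubsets-cong n (λ S → ⊗-congˡ ([ isIndependent (adj G) S ]x^ card S)
                                            (∏-cong (λ i → if-cong (lookup S (c i))))) ⟩
    ∑[ S ⊆ n ] ([ isIndependent (adj G) S ]x^ card S ⊗ ∏ (λ i → if lookup S (c i) then one else I H ⊗ I H)) ∎
    where
    open ≋-Reasoning
    if-cong : ∀ b → (if b then one else indepPolyAdj unionAdj) ≋ (if b then one else I H ⊗ I H)
    if-cong true  = ≋-refl
    if-cong false = union-indepPoly (irrefl H) (irrefl H)

  triangle-indepPoly : I-triangle G C H ≋
    ∑[ S ⊆ n ] ([ isIndependent (adj G) S ]x^ card S ⊗
                ∏ (λ i → if lookup S (c i) ∨ lookup S (c (nextIdx i)) then one else I H))
  triangle-indepPoly = ≋-trans (indepPolyAdj-cong triangle-is-pendant)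
    (Triangle.pendant-indepPoly (irrefl G) (irrefl H)
      (λ S i → lookup S (c i) ∨ lookup S (c (nextIdx i))) (λ S i → avoids-both⇔ S (c i) (c (nextIdx i))))

cycle-apart : ∀ {G} (C : Cycle G) S → isIndependent (adj G) S ≡ true →
              ∀ i → lookup S (vtx C i) ∧ lookup S (vtx C (nextIdx i)) ≡ false
cycle-apart {G} C S indep i with lookup S (vtx C i) in Sc | lookup S (vtx C (nextIdx i)) in Sc′
... | false | _     = refl
... | true  | false = refl
... | true  | true  = trans (sym (edges C i)) (to (isIndependent⇔ (irrefl G) S) indep _ _ Sc Sc′)

-- Multiply the triangle decomposition by I(H)^|C| and apply the cycle
-- identity to the term of every independent set S of G; the result is the
-- corona decomposition.
lemma3 : (G : Graph) (C : Cycle G) (H : Graph) →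
         ∀ (k : ℕ) → I-corona G C H k ≡ ((I H ^^ ∣ C ∣C) ⊗ I-triangle G C H) k
lemma3 G C H = ≋-sym (begin
  P^q ⊗ I-triangle G C H                                   ≈⟨ ⊗-congˡ P^q triangle-indepPoly ⟩
  P^q ⊗ (∑[ S ⊆ size G ] (weight S ⊗ ∏ (edgeFactor S)))    ≈⟨ ⊗-sumList (allSubsets (size G)) _ P^q ⟩
  ∑[ S ⊆ size G ] (P^q ⊗ (weight S ⊗ ∏ (edgeFactor S)))    ≈⟨ sumSubsets-cong (size G) per-set ⟩
  ∑[ S ⊆ size G ] (weight S ⊗ ∏ (vertexFactor S))          ≈⟨ corona-indepPoly ⟨
  I-corona G C H                                           ∎)
  where
  open ≋-Reasoning
  open Constructions G C H
  P^q : Poly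
  P^q = I H ^^ ∣ C ∣C
  weight : Vec Bool (size G) → Poly
  weight S = [ isIndependent (adj G) S ]x^ card S
  edgeFactor vertexFactor : Vec Bool (size G) → Fin ∣ C ∣C → Poly
  edgeFactor   S i = if lookup S (vtx C i) ∨ lookup S (vtx C (nextIdx i)) then one else I H
  vertexFactor S i = if lookup S (vtx C i) then one else I H ⊗ I H

  per-set : ∀ S → P^q ⊗ (weight S ⊗ ∏ (edgeFactor S)) ≋ weight S ⊗ ∏ (vertexFactor S)
  per-set S = ≋-trans (x∙yz≈y∙xz P^q (weight S) (∏ (edgeFactor S)))
    ([]x^-guard (isIndependent (adj G) S) (card S) (λ indep →
       cycle-identity (len C) (I H) (λ i → lookup S (vtx C i)) (cycle-apart C S indep)))
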